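{- Let $\mathcal{I}$ be either $\mathcal{I}_\omega$ or $\mathcal{I}_0$. For every set of terms $\Gamma$ and every term $t$, $\Gamma\Vdash_{\mathcal{I}}t$ holds if and only if $\Gamma\vdash_{\mathcal{I}}t$.
   Context: Let $\mathcal{B}$ be a finite set of base types and $\Sigma$ a set of constants containing $\Xi$, $L$, and $A_\tau$ for each $\tau\in\mathcal{B}$. Terms are type-free $\lambda$-terms over $\Sigma$, up to $\alpha$-conversion. Abbreviations: $K\equiv\lambda xy.x$, $H\equiv\lambda x.L(Kx)$, $\supset\ \equiv\lambda xy.\Xi(Kx)(Ky)$ (infix), $F\equiv\lambda xyf.\Xi x(\lambda z.y(fz))$. Judgements $\Gamma\vdash t$, $\Gamma$ finite. $\mathcal{I}_\omega$: axioms $\Gamma,t\vdash t$; $\Gamma\vdash LH$; $\Gamma\vdash LA_\tau$ ($\tau\in\mathcal{B}$); rules: (Eq) from $\Gamma\vdash t_1$, $t_1=_{\beta\eta}t_2$ infer $\Gamma\vdash t_2$; $(H_i)$ from $\Gamma\vdash t$ infer $\Gamma\vdash Ht$; $(\Xi_e)$ from $\Gamma\vdash\Xi t_1t_2$, $\Gamma\vdash t_1t_3$ infer $\Gamma\vdash t_2t_3$; $(\Xi_i)$ from $\Gamma,t_1x\vdash t_2x$, $\Gamma\vdash Lt_1$ infer $\Gamma\vdash\Xi t_1t_2$; $(\Xi_H)$ from $\Gamma,t_1x\vdash H(t_2x)$, $\Gamma\vdash Lt_1$ infer $\Gamma\vdash H(\Xi t_1t_2)$; $(F_L)$ from $\Gamma,t_1x\vdash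 Lt_2$, $\Gamma\vdash Lt_1$ infer $\Gamma\vdash L(Ft_1t_2)$; with $x$ not free in $\Gamma,t_1,t_2$ in the last three. $\mathcal{I}_0$ is $\mathcal{I}_\omega$ without $(F_L)$. For arbitrary $\Gamma$, $\Gamma\vdash_{\mathcal{I}}t$ means some finite $\Gamma'\subseteq\Gamma$ has $\Gamma'\vdash t$ derivable in $\mathcal{I}$. A combinatory algebra is $(C,\cdot,S,K)$ with $\cdot$ binary on $C$ (left-associative), $S,K\in C$, $SXYZ=(XZ)(YZ)$ and $KXY=X$; it is extensional if $M_1X=M_2X$ for all $X$ implies $M_1=M_2$. An illative Kripke pre-model is $(\mathcal{S},\le,\mathcal{C},I,\varsigma)$: a set of states $\mathcal{S}$, a partial order $\le$ on it, an extensional combinatory algebra $\mathcal{C}$, a map $I:\Sigma\to\mathcal{C}$, and $\varsigma$ assigning to each element of $\mathcal{C}$ an upward-closed subset of $\mathcal{S}$. For a valuation $u$ (variables to $\mathcal{C}$): $[\![x]\!]_u=u(x)$, $[\![c]\!]_u=I(c)$, $[\![t_1t_2]\!]_u=[\![t_1]\!]_u\cdot[\![t_2]\!]_u$, and $[\![\lambda x.t]\!]_u$ is the unique $d$ with $d\cdot d'=[\![t]\!]_{u[x/d']}$ for all $d'\in\mathcal{C}$. Below, $\Xi,L,H,F,A_\tau,\supset$ denote the values of these closed terms. An illative Kripke model for $\mathcal{I}_\omega$ is a pre-model such that for all $X,Y\in\mathcal{C}$ and $s\in\mathcal{S}$: (1) if $s\in\varsigma(LX)$ and for all $s'\ge s$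 and $Z$ with $s'\in\varsigma(XZ)$ we have $s'\in\varsigma(YZ)$, then $s\in\varsigma(\Xi XY)$; (2) if $s\in\varsigma(\Xi XY)$ then for all $Z$ with $s\in\varsigma(XZ)$, $s\in\varsigma(YZ)$; (3) if $s\in\varsigma(LX)$ and for all $s'\ge s$ and $Z$ with $s'\in\varsigma(XZ)$ we have $s'\in\varsigma(H(YZ))$, then $s\in\varsigma(H(\Xi XY))$; (4) if $s\in\varsigma(LX)$ and every $s'\ge s$ such that $s'\in\varsigma(XZ)$ for some $Z$ satisfies $s'\in\varsigma(LY)$, then $s\in\varsigma(L(FXY))$; (5) $s\in\varsigma(X)$ implies $s\in\varsigma(HX)$; (6) $s\in\varsigma(LH)$; (7) $s\in\varsigma(LA_\tau)$ for $\tau\in\mathcal{B}$. An illative Kripke model for $\mathcal{I}_0$ satisfies the same conditions except (4). Write $s,u\Vdash t$ if $s\in\varsigma([\![t]\!]_u)$. $\Gamma\Vdash_{\mathcal{I}}t$ means: for every illative Kripke model for $\mathcal{I}$, every state $s$ and every valuation $u$ with $s,u\Vdash t'$ for all $t'\in\Gamma$, we have $s,u\Vdash t$. -}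

module Defs where

open import Level using (Level; _⊔_; Lift) renaming (suc to lsuc; zero to lzero)
open import Data.Nat using (ℕ; zero; suc)
open import Data.Fin using (Fin)
open import Data.Product using (Σ; ∃; ∃-syntax; _×_; _,_)
open import Data.List using (List; _∷_; [])
open import Data.List.Membership.Propositional using (_∈_)
open import Data.List.Relation.Unary.All using (All)
open import Data.Unit using (⊤)
open import Relation.Nullary using (¬_)
open import Relation.Binary using (Rel; IsEquivalence; IsPartialOrder)
open import Relation.Binary.PropositionalEquality using (_≡_; _≢_)
open import Function.Bundles using (_↔_)

record Sig : Set₁ where
  field
    Base      : Set
    finite    : ∃[ n ] (Base ↔ Fin n)
    Const     : Set
    Ξc        : Const
    Lc        : Const
    Ac        : Base → Const
    Ξ≢L       : Ξc ≢ Lc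
    Ξ≢A       : ∀ τ → Ξc ≢ Ac τ
    L≢A       : ∀ τ → Lc ≢ Ac τ
    A-inj     : ∀ τ τ' → Ac τ ≡ Ac τ' → τ ≡ τ'

-- Type-free λ-terms over a set of constants, in de Bruijn notation
-- (this is "terms up to α-conversion"). The free variable x is the
-- index x at binder depth 0.

data Tm (C : Set) : Set where
  var : ℕ → Tm C
  con : C → Tm C
  app : Tm C → Tm C → Tm C
  lam : Tm C → Tm C

module _ {C : Set} where

  ext : (ℕ → ℕ) → ℕ → ℕ
  ext ρ zero    = zero
  ext ρ (suc n) = suc (ρ n)

  ren : (ℕ → ℕ) → Tm C → Tm C
  ren ρ (var n)   = var (ρ n)
  ren ρ (con c)   = con c
  ren ρ (app t s) = app (ren ρ t) (ren ρ s)
  ren ρ (lam t)   = lam (ren (ext ρ) t)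

  exts : (ℕ → Tm C) → ℕ → Tm C
  exts σ zero    = var zero
  exts σ (suc n) = ren suc (σ n)

  sub : (ℕ → Tm C) → Tm C → Tm C
  sub σ (var n)   = σ n
  sub σ (con c)   = con c
  sub σ (app t s) = app (sub σ t) (sub σ s)
  sub σ (lam t)   = lam (sub (exts σ) t)

  single : Tm C → ℕ → Tm C
  single s zero    = s
  single s (suc n) = var n

  infix 4 _=βη_
  data _=βη_ : Tm C → Tm C → Set where
    β      : ∀ t s → app (lam t) s =βη sub (single s) t
    η      : ∀ t → lam (app (ren suc t) (var zero)) =βη t
    refl   : ∀ {t} → t =βη t
    sym    : ∀ {t s} → t =βη s → s =βη t
    trans  : ∀ {t s r} → t =βη s → s =βη r → t =βη r
    appcong : ∀ {t t' s s'} → t =βη t' → s =βη s' → app t s =βη app t' s'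
    lamcong : ∀ {t t'} → t =βη t' → lam t =βη lam t'

  data _freeIn_ : ℕ → Tm C → Set where
    here  : ∀ {x} → x freeIn var x
    appl  : ∀ {x t s} → x freeIn t → x freeIn app t s
    appr  : ∀ {x t s} → x freeIn s → x freeIn app t s
    under : ∀ {x t} → suc x freeIn t → x freeIn lam t

data System : Set where
  𝓘ω 𝓘₀ : System

module _ (sig : Sig) where
  open Sig sig

  Term : Set
  Term = Tm Const

  Ξt Lt : Term
  Ξt = con Ξc
  Lt = con Lc

  At : Base → Term
  At τ = con (Ac τ)

  Kt : Term
  Kt = lam (lam (var 1))

  Ht : Term                         -- λx.L(Kx)
  Ht = lam (app Lt (app Kt (var 0)))

  ⊃t : Term                         -- λxy.Ξ(Kx)(Ky)
  ⊃t = lam (lam (app (app Ξt (app Kt (var 1))) (app Kt (var 0))))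

  Ft : Term                         -- λxyf.Ξx(λz.y(fz))
  Ft = lam (lam (lam (app (app Ξt (var 2)) (lam (app (var 2) (app (var 1) (var 0)))))))

  -- Derivations Γ ⊢ t with Γ finite (a list; only membership matters)

  data _⊢[_]_ : List Term → System → Term → Set where
    ax   : ∀ {Γ 𝓘 t} → t ∈ Γ → Γ ⊢[ 𝓘 ] t
    LH   : ∀ {Γ 𝓘} → Γ ⊢[ 𝓘 ] app Lt Ht
    LA   : ∀ {Γ 𝓘} τ → Γ ⊢[ 𝓘 ] app Lt (At τ)
    Eq   : ∀ {Γ 𝓘 t₁ t₂} → Γ ⊢[ 𝓘 ] t₁ → t₁ =βη t₂ → Γ ⊢[ 𝓘 ] t₂
    Hi   : ∀ {Γ 𝓘 t} → Γ ⊢[ 𝓘 ] t → Γ ⊢[ 𝓘 ] app Ht t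
    Ξe   : ∀ {Γ 𝓘 t₁ t₂ t₃} → Γ ⊢[ 𝓘 ] app (app Ξt t₁) t₂ → Γ ⊢[ 𝓘 ] app t₁ t₃
           → Γ ⊢[ 𝓘 ] app t₂ t₃
    Ξi   : ∀ {Γ 𝓘 t₁ t₂} (x : ℕ) → All (λ t → ¬ x freeIn t) Γ
           → ¬ x freeIn t₁ → ¬ x freeIn t₂
           → (app t₁ (var x) ∷ Γ) ⊢[ 𝓘 ] app t₂ (var x) → Γ ⊢[ 𝓘 ] app Lt t₁
           → Γ ⊢[ 𝓘 ] app (app Ξt t₁) t₂
    ΞH   : ∀ {Γ 𝓘 t₁ t₂} (x : ℕ) → All (λ t → ¬ x freeIn t) Γ
           → ¬ x freeIn t₁ → ¬ x freeIn t₂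
           → (app t₁ (var x) ∷ Γ) ⊢[ 𝓘 ] app Ht (app t₂ (var x)) → Γ ⊢[ 𝓘 ] app Lt t₁
           → Γ ⊢[ 𝓘 ] app Ht (app (app Ξt t₁) t₂)
    FL   : ∀ {Γ t₁ t₂} (x : ℕ) → All (λ t → ¬ x freeIn t) Γ
           → ¬ x freeIn t₁ → ¬ x freeIn t₂
           → (app t₁ (var x) ∷ Γ) ⊢[ 𝓘ω ] app Lt t₂ → Γ ⊢[ 𝓘ω ] app Lt t₁
           → Γ ⊢[ 𝓘ω ] app Lt (app (app Ft t₁) t₂)

  Derivable : System → (Term → Set) → Term → Set
  Derivable 𝓘 Γ t = ∃[ Γ' ] (All Γ Γ' × Γ' ⊢[ 𝓘 ] t)

-- Extensional combinatory algebras (over a setoid, since Agda has no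
-- quotient types)

record CombAlg (ℓ : Level) : Set (lsuc ℓ) where
  infixl 9 _·_
  infix 4 _≈_
  field
    Carrier : Set ℓ
    _≈_     : Rel Carrier ℓ
    isEquiv : IsEquivalence _≈_
    _·_     : Carrier → Carrier → Carrier
    ·-cong  : ∀ {X X' Y Y'} → X ≈ X' → Y ≈ Y' → X · Y ≈ X' · Y'
    S K     : Carrier
    S-law   : ∀ X Y Z → S · X · Y · Z ≈ (X · Z) · (Y · Z)
    K-law   : ∀ X Y → K · X · Y ≈ X
    extensional : ∀ M₁ M₂ → (∀ X → M₁ · X ≈ M₂ · X) → M₁ ≈ M₂

-- Interpretation of λ-terms in a combinatory algebra.  [[λx.t]]_u is
-- the (by extensionality unique) d with d·d' = [[t]]_{u[x/d']}; it is
-- computed here by bracket abstraction.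

data CL (C : Set) : Set where
  cvar : ℕ → CL C
  ccon : C → CL C
  cS cK : CL C
  cap : CL C → CL C → CL C

module _ {C : Set} where

  abs : CL C → CL C
  abs (cvar zero)    = cap (cap cS cK) cK
  abs (cvar (suc n)) = cap cK (cvar n)
  abs (ccon c)       = cap cK (ccon c)
  abs cS             = cap cK cS
  abs cK             = cap cK cK
  abs (cap a b)      = cap (cap cS (abs a)) (abs b)

  toCL : Tm C → CL C
  toCL (var n)   = cvar n
  toCL (con c)   = ccon c
  toCL (app t s) = cap (toCL t) (toCL s)
  toCL (lam t)   = abs (toCL t)

module Interp {ℓ} {C : Set} (𝓒 : CombAlg ℓ) (I : C → CombAlg.Carrier 𝓒) where
  open CombAlg 𝓒

  evalCL : (ℕ → Carrier) → CL C → Carrier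
  evalCL u (cvar n)  = u n
  evalCL u (ccon c)  = I c
  evalCL u cS        = S
  evalCL u cK        = K
  evalCL u (cap a b) = evalCL u a · evalCL u b

  ⟦_⟧ : Tm C → (ℕ → Carrier) → Carrier
  ⟦ t ⟧ u = evalCL u (toCL t)

  -- value of a closed term (the valuation is irrelevant)
  ⟦_⟧₀ : Tm C → Carrier
  ⟦ t ⟧₀ = ⟦ t ⟧ (λ _ → K)

record PreModel (sig : Sig) (ℓ : Level) : Set (lsuc ℓ) where
  open Sig sig
  field
    State   : Set ℓ
    _≤_     : Rel State ℓ
    isPO    : IsPartialOrder _≡_ _≤_
    alg     : CombAlg ℓ
  open CombAlg alg public
  field
    I       : Const → Carrier
    ς       : Carrier → State → Set ℓ
    ς-up    : ∀ {X s s'} → s ≤ s' → ς X s → ς X s'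
    ς-resp  : ∀ {X Y s} → X ≈ Y → ς X s → ς Y s
  open Interp alg I public

module _ {sig : Sig} {ℓ : Level} (M : PreModel sig ℓ) where
  open Sig sig
  open PreModel M

  Ξᵐ Lᵐ Hᵐ Fᵐ : Carrier
  Ξᵐ = ⟦ Ξt sig ⟧₀
  Lᵐ = ⟦ Lt sig ⟧₀
  Hᵐ = ⟦ Ht sig ⟧₀
  Fᵐ = ⟦ Ft sig ⟧₀

  Cond4 : System → Set ℓ
  Cond4 𝓘ω = ∀ X Y s → ς (Lᵐ · X) s
             → (∀ s' → s ≤ s' → ∀ Z → ς (X · Z) s' → ς (Lᵐ · Y) s')
             → ς (Lᵐ · (Fᵐ · X · Y)) s
  Cond4 𝓘₀ = Lift ℓ ⊤

  record IsModel (𝓘 : System) : Set ℓ where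
    field
      cond1 : ∀ X Y s → ς (Lᵐ · X) s
              → (∀ s' → s ≤ s' → ∀ Z → ς (X · Z) s' → ς (Y · Z) s')
              → ς (Ξᵐ · X · Y) s
      cond2 : ∀ X Y s → ς (Ξᵐ · X · Y) s → ∀ Z → ς (X · Z) s → ς (Y · Z) s
      cond3 : ∀ X Y s → ς (Lᵐ · X) s
              → (∀ s' → s ≤ s' → ∀ Z → ς (X · Z) s' → ς (Hᵐ · (Y · Z)) s')
              → ς (Hᵐ · (Ξᵐ · X · Y)) s
      cond4 : Cond4 𝓘
      cond5 : ∀ X s → ς X s → ς (Hᵐ · X) s
      cond6 : ∀ s → ς (Lᵐ · Hᵐ) s
      cond7 : ∀ τ s → ς (Lᵐ · ⟦ At sig τ ⟧₀) s

-- Γ ⊩_𝓘 t, relative to models whose components live in universe level ℓ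
Valid : (sig : Sig) → System → (ℓ : Level) → (Tm (Sig.Const sig) → Set)
        → Tm (Sig.Const sig) → Set (lsuc ℓ)
Valid sig 𝓘 ℓ Γ t =
  (M : PreModel sig ℓ) → IsModel M 𝓘 →
  let open PreModel M in
  ∀ (s : State) (u : ℕ → Carrier) →
  (∀ t' → Γ t' → ς (⟦ t' ⟧ u) s) → ς (⟦ t ⟧ u) s

-- Soundness is an induction on derivations.  Its semantic backbone is that
-- the interpretation of λ-terms in an extensional combinatory algebra
-- respects renaming, substitution and hence βη-conversion, and that a
-- variable not free in a term can be reassigned without changing its value;
-- the latter handles the eigenvariable rules Ξi, ΞH and FL.
--
-- Completeness uses a canonical Kripke model.  Its combinatory algebra is the
-- algebra of λ-terms modulo βη, in which interpretation is substitution.  A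
-- state is a finite list Δ of extra hypotheses, ordered by extension, and a
-- term holds at Δ when it is derivable from Δ together with finitely many
-- members of Γ.  Since Γ may be infinite, its members are renamed to even
-- variables; odd variables are then always fresh, which supplies the
-- eigenvariables needed to verify the model conditions.  Reading the
-- canonical model at the empty state under the valuation x ↦ 2x and renaming
-- back gives a derivation of t.  To make this work, derivations are shown to
-- be closed under arbitrary renamings of variables (and so under weakening).

module Submission where

open import Defs
open import Level using (Level; Lift; lift; lower)
open import Data.Nat using (ℕ; zero; suc; _≤_; _<_; _⊔_; _*_; _/_)
open import Data.Nat.Properties
  using (_≟_; ≤-refl; ≤-trans; <-≤-trans; <⇒≢; n≤1+n; m≤m⊔n; m≤n⊔m; m≤n*m; *-comm;
         even≢odd; suc-injective)
open import Data.Nat.DivMod using (m*n/n≡m)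
open import Data.Product using (∃-syntax; _×_; _,_; proj₁; proj₂)
open import Data.Unit using (tt)
open import Data.Empty using (⊥-elim)
open import Data.List using (List; []; _∷_; _++_; map)
open import Data.List.Properties using (++-assoc; ++-identityˡ-unique; ++-conicalʳ)
open import Data.List.Membership.Propositional using (_∈_)
open import Data.List.Membership.Propositional.Properties using (∈-map⁻)
open import Data.List.Relation.Unary.Any using (here; there)
open import Data.List.Relation.Unary.All as All using (All; []; _∷_)
import Data.List.Relation.Unary.All.Properties as AllP
open import Data.List.Relation.Binary.Subset.Propositional using (_⊆_)
import Data.List.Relation.Binary.Subset.Propositional.Properties as ⊆
open import Relation.Nullary using (¬_; yes; no)
open import Relation.Binary using (Setoid; IsEquivalence; IsPartialOrder)
open import Relation.Binary.PropositionalEquality as ≡ using (_≡_; _≢_; cong; cong₂; subst)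
open import Function.Bundles using (_⇔_; mk⇔)

_[_↦_] : ∀ {a} {A : Set a} → (ℕ → A) → ℕ → A → ℕ → A
(f [ x ↦ d ]) k with k ≟ x
... | yes _ = d
... | no _  = f k

update-same : ∀ {a} {A : Set a} (f : ℕ → A) (x : ℕ) (d : A) → (f [ x ↦ d ]) x ≡ d
update-same f x d with x ≟ x
... | yes _   = ≡.refl
... | no x≢x  = ⊥-elim (x≢x ≡.refl)

update-other : ∀ {a} {A : Set a} (f : ℕ → A) {x : ℕ} (d : A) {k : ℕ} → k ≢ x → (f [ x ↦ d ]) k ≡ f k
update-other f {x} d {k} k≢x with k ≟ x
... | yes k≡x = ⊥-elim (k≢x k≡x)
... | no _    = ≡.refl

_∷ᵥ_ : ∀ {a} {A : Set a} → A → (ℕ → A) → ℕ → A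
(d ∷ᵥ u) zero    = d
(d ∷ᵥ u) (suc n) = u n

module _ {C : Set} where

  ≡⇒βη : {a b : Tm C} → a ≡ b → a =βη b
  ≡⇒βη ≡.refl = refl

  βη-setoid : Setoid _ _
  βη-setoid = record
    { Carrier = Tm C ; _≈_ = _=βη_
    ; isEquivalence = record { refl = refl ; sym = sym ; trans = trans } }

  _#_ : ℕ → Tm C → Set
  x # t = ¬ x freeIn t

  ren-cong-free : (t : Tm C) {ρ ρ' : ℕ → ℕ} → (∀ x → x freeIn t → ρ x ≡ ρ' x) → ren ρ t ≡ ren ρ' t
  ren-cong-free (var n)   h = cong var (h n here)
  ren-cong-free (con c)   h = ≡.refl
  ren-cong-free (app t s) h =
    cong₂ app (ren-cong-free t (λ x p → h x (appl p))) (ren-cong-free s (λ x p → h x (appr p)))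
  ren-cong-free (lam t) {ρ} {ρ'} h = cong lam (ren-cong-free t h')
    where h' : ∀ x → x freeIn t → ext {C} ρ x ≡ ext {C} ρ' x
          h' zero    p = ≡.refl
          h' (suc x) p = cong suc (h x (under p))

  ren-cong : (t : Tm C) {ρ ρ' : ℕ → ℕ} → (∀ x → ρ x ≡ ρ' x) → ren ρ t ≡ ren ρ' t
  ren-cong t h = ren-cong-free t (λ x _ → h x)

  sub-cong : (t : Tm C) {σ σ' : ℕ → Tm C} → (∀ x → σ x ≡ σ' x) → sub σ t ≡ sub σ' t
  sub-cong (var n)   h = h n
  sub-cong (con c)   h = ≡.refl
  sub-cong (app t s) h = cong₂ app (sub-cong t h) (sub-cong s h)
  sub-cong (lam t) {σ} {σ'} h = cong lam (sub-cong t h')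
    where h' : ∀ x → exts σ x ≡ exts σ' x
          h' zero    = ≡.refl
          h' (suc x) = cong (ren suc) (h x)

  ren-update-fresh : (t : Tm C) (ρ : ℕ → ℕ) {x : ℕ} (y : ℕ) → x # t → ren (ρ [ x ↦ y ]) t ≡ ren ρ t
  ren-update-fresh t ρ y x#t =
    ren-cong-free t (λ k p → update-other ρ y (λ k≡x → x#t (subst (_freeIn t) k≡x p)))

  ren-ren : (t : Tm C) (ρ σ : ℕ → ℕ) → ren ρ (ren σ t) ≡ ren (λ x → ρ (σ x)) t
  ren-ren (var n)   ρ σ = ≡.refl
  ren-ren (con c)   ρ σ = ≡.refl
  ren-ren (app t s) ρ σ = cong₂ app (ren-ren t ρ σ) (ren-ren s ρ σ)
  ren-ren (lam t)   ρ σ = cong lam (≡.trans (ren-ren t (ext {C} ρ) (ext {C} σ)) (ren-cong t h))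
    where h : ∀ x → ext {C} ρ (ext {C} σ x) ≡ ext {C} (λ x → ρ (σ x)) x
          h zero    = ≡.refl
          h (suc x) = ≡.refl

  sub-ren : (t : Tm C) (σ : ℕ → Tm C) (ρ : ℕ → ℕ) → sub σ (ren ρ t) ≡ sub (λ x → σ (ρ x)) t
  sub-ren (var n)   σ ρ = ≡.refl
  sub-ren (con c)   σ ρ = ≡.refl
  sub-ren (app t s) σ ρ = cong₂ app (sub-ren t σ ρ) (sub-ren s σ ρ)
  sub-ren (lam t)   σ ρ = cong lam (≡.trans (sub-ren t (exts σ) (ext {C} ρ)) (sub-cong t h))
    where h : ∀ x → exts σ (ext {C} ρ x) ≡ exts (λ x → σ (ρ x)) x
          h zero    = ≡.refl
          h (suc x) = ≡.refl

  ren-sub : (t : Tm C) (ρ : ℕ → ℕ) (σ : ℕ → Tm C) → ren ρ (sub σ t) ≡ sub (λ x → ren ρ (σ x)) t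
  ren-sub (var n)   ρ σ = ≡.refl
  ren-sub (con c)   ρ σ = ≡.refl
  ren-sub (app t s) ρ σ = cong₂ app (ren-sub t ρ σ) (ren-sub s ρ σ)
  ren-sub (lam t)   ρ σ = cong lam (≡.trans (ren-sub t (ext {C} ρ) (exts σ)) (sub-cong t h))
    where h : ∀ x → ren (ext {C} ρ) (exts σ x) ≡ exts (λ x → ren ρ (σ x)) x
          h zero    = ≡.refl
          h (suc x) = ≡.trans (ren-ren (σ x) (ext {C} ρ) suc) (≡.sym (ren-ren (σ x) suc ρ))

  sub-sub : (t : Tm C) (τ σ : ℕ → Tm C) → sub τ (sub σ t) ≡ sub (λ x → sub τ (σ x)) t
  sub-sub (var n)   τ σ = ≡.refl
  sub-sub (con c)   τ σ = ≡.refl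
  sub-sub (app t s) τ σ = cong₂ app (sub-sub t τ σ) (sub-sub s τ σ)
  sub-sub (lam t)   τ σ = cong lam (≡.trans (sub-sub t (exts τ) (exts σ)) (sub-cong t h))
    where h : ∀ x → sub (exts τ) (exts σ x) ≡ exts (λ x → sub τ (σ x)) x
          h zero    = ≡.refl
          h (suc x) = ≡.trans (sub-ren (σ x) (exts τ) suc) (≡.sym (ren-sub (σ x) suc τ))

  sub-var : (t : Tm C) (ρ : ℕ → ℕ) → sub (λ x → var (ρ x)) t ≡ ren ρ t
  sub-var (var n)   ρ = ≡.refl
  sub-var (con c)   ρ = ≡.refl
  sub-var (app t s) ρ = cong₂ app (sub-var t ρ) (sub-var s ρ)
  sub-var (lam t)   ρ = cong lam (≡.trans (sub-cong t h) (sub-var t (ext {C} ρ)))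
    where h : ∀ x → exts (λ x → var (ρ x)) x ≡ var (ext {C} ρ x)
          h zero    = ≡.refl
          h (suc x) = ≡.refl

  ren-id : (t : Tm C) {ρ : ℕ → ℕ} → (∀ x → ρ x ≡ x) → ren ρ t ≡ t
  ren-id t h = ≡.trans (ren-cong t h) (ren-id′ t)
    where ren-id′ : (t : Tm C) → ren (λ x → x) t ≡ t
          ren-id′ (var n)   = ≡.refl
          ren-id′ (con c)   = ≡.refl
          ren-id′ (app t s) = cong₂ app (ren-id′ t) (ren-id′ s)
          ren-id′ (lam t)   = cong lam (≡.trans (ren-cong t h′) (ren-id′ t))
            where h′ : ∀ x → ext {C} (λ x → x) x ≡ x
                  h′ zero    = ≡.refl
                  h′ (suc x) = ≡.refl

  ren-inverse : (t : Tm C) {ρ σ : ℕ → ℕ} → (∀ x → ρ (σ x) ≡ x) → ren ρ (ren σ t) ≡ t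
  ren-inverse t {ρ} {σ} h = ≡.trans (ren-ren t ρ σ) (ren-id t h)

  sub-after-ren : (t : Tm C) (σ : ℕ → Tm C) (ρ : ℕ → ℕ) → (∀ x → σ (ρ x) ≡ var x)
                  → sub σ (ren ρ t) ≡ t
  sub-after-ren t σ ρ h = ≡.trans (sub-ren t σ ρ)
    (≡.trans (sub-cong t h) (≡.trans (sub-var t (λ x → x)) (ren-id t (λ _ → ≡.refl))))

  ren-βη : {t s : Tm C} (ρ : ℕ → ℕ) → t =βη s → ren ρ t =βη ren ρ s
  ren-βη ρ (β t s) = trans (β _ _) (≡⇒βη (≡.trans (sub-ren t _ (ext {C} ρ))
                       (≡.trans (sub-cong t h) (≡.sym (ren-sub t ρ (single s))))))
    where h : ∀ x → single (ren ρ s) (ext {C} ρ x) ≡ ren ρ (single s x)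
          h zero    = ≡.refl
          h (suc x) = ≡.refl
  ren-βη ρ (η t) = trans (≡⇒βη (cong (λ z → lam (app z (var zero)))
                     (≡.trans (ren-ren t (ext {C} ρ) suc) (≡.sym (ren-ren t suc ρ))))) (η (ren ρ t))
  ren-βη ρ refl          = refl
  ren-βη ρ (sym p)       = sym (ren-βη ρ p)
  ren-βη ρ (trans p q)   = trans (ren-βη ρ p) (ren-βη ρ q)
  ren-βη ρ (appcong p q) = appcong (ren-βη ρ p) (ren-βη ρ q)
  ren-βη ρ (lamcong p)   = lamcong (ren-βη (ext {C} ρ) p)

  bound : Tm C → ℕ
  bound (var n)   = suc n
  bound (con c)   = zero
  bound (app t s) = bound t ⊔ bound s
  bound (lam t)   = bound t

  free⇒<bound : (t : Tm C) {x : ℕ} → x freeIn t → x < bound t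
  free⇒<bound (var n)   here     = ≤-refl
  free⇒<bound (app t s) (appl p) = <-≤-trans (free⇒<bound t p) (m≤m⊔n _ _)
  free⇒<bound (app t s) (appr p) = <-≤-trans (free⇒<bound s p) (m≤n⊔m _ _)
  free⇒<bound (lam t)   (under p) = ≤-trans (n≤1+n _) (free⇒<bound t p)

  boundAll : List (Tm C) → ℕ
  boundAll []       = zero
  boundAll (t ∷ ts) = bound t ⊔ boundAll ts

  fresh-list : (ts : List (Tm C)) {x : ℕ} → boundAll ts ≤ x → All (x #_) ts
  fresh-list []       le = []
  fresh-list (t ∷ ts) le =
    (λ p → <⇒≢ (<-≤-trans (free⇒<bound t p) (≤-trans (m≤m⊔n _ _) le)) ≡.refl)
    ∷ fresh-list ts (≤-trans (m≤n⊔m (bound t) _) le)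

  freeIn-ren : (t : Tm C) {x : ℕ} (ρ : ℕ → ℕ) → x freeIn ren ρ t → ∃[ y ] (y freeIn t × x ≡ ρ y)
  freeIn-ren (var n)   ρ here = n , here , ≡.refl
  freeIn-ren (app t s) ρ (appl p) with freeIn-ren t ρ p
  ... | y , q , e = y , appl q , e
  freeIn-ren (app t s) ρ (appr p) with freeIn-ren s ρ p
  ... | y , q , e = y , appr q , e
  freeIn-ren (lam t)   ρ (under p) with freeIn-ren t (ext {C} ρ) p
  ... | suc y , q , e = y , under q , suc-injective e

  -- Syntactic extensionality: terms agreeing on all arguments are βη-equal
  -- (apply both to a fresh variable and abstract it again by η).
  extensional-βη : (M₁ M₂ : Tm C) → (∀ X → app M₁ X =βη app M₂ X) → M₁ =βη M₂
  extensional-βη M₁ M₂ h = begin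
      M₁                                 ≈⟨ η M₁ ⟨
      lam (app (ren suc M₁) (var zero))  ≡⟨ cong lam (abstract-fresh M₁ M₁#n) ⟨
      lam (ren ρ (app M₁ (var n)))       ≈⟨ lamcong (ren-βη ρ (h (var n))) ⟩
      lam (ren ρ (app M₂ (var n)))       ≡⟨ cong lam (abstract-fresh M₂ M₂#n) ⟩
      lam (app (ren suc M₂) (var zero))  ≈⟨ η M₂ ⟩
      M₂                                 ∎
    where
      open import Relation.Binary.Reasoning.Setoid βη-setoid
      n = boundAll (M₁ ∷ M₂ ∷ [])
      fresh = fresh-list (M₁ ∷ M₂ ∷ []) ≤-refl
      M₁#n = All.head fresh
      M₂#n = All.head (All.tail fresh)
      ρ = suc [ n ↦ zero ]
      abstract-fresh : (M : Tm C) → n # M → ren ρ (app M (var n)) ≡ app (ren suc M) (var zero)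
      abstract-fresh M n#M = cong₂ app (ren-update-fresh M suc zero n#M) (cong var (update-same suc n zero))

-- Renaming a derivation: every rule is stable under renaming of variables,
-- provided eigenvariables are moved to fresh ones.
module Derivations (sig : Sig) where

  infix 3 _⊢⟨_⟩_
  _⊢⟨_⟩_ : List (Term sig) → System → Term sig → Set
  Δ ⊢⟨ 𝓘 ⟩ t = _⊢[_]_ sig Δ 𝓘 t

  ⊢-cast : ∀ {Δ 𝓘 a b} → a ≡ b → Δ ⊢⟨ 𝓘 ⟩ a → Δ ⊢⟨ 𝓘 ⟩ b
  ⊢-cast ≡.refl d = d

  RenamesInto : (ℕ → ℕ) → List (Term sig) → List (Term sig) → Set
  RenamesInto ρ Δ Δ' = ∀ {g} → g ∈ Δ → ren ρ g ∈ Δ'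

  record EigenRenaming (ρ : ℕ → ℕ) (x : ℕ) (Δ Δ' : List (Term sig)) (t₁ t₂ : Term sig) : Set where
    field
      y        : ℕ
      fresh-Δ' : All (y #_) Δ'
      fresh₁   : y # ren ρ t₁
      fresh₂   : y # ren ρ t₂
      premise  : RenamesInto (ρ [ x ↦ y ]) (app t₁ (var x) ∷ Δ) (app (ren ρ t₁) (var y) ∷ Δ')
      subject₂ : ren (ρ [ x ↦ y ]) t₂ ≡ ren ρ t₂
      eigen    : (ρ [ x ↦ y ]) x ≡ y

  eigenRenaming : ∀ ρ {x Δ Δ'} t₁ t₂ → All (x #_) Δ → x # t₁ → x # t₂ → RenamesInto ρ Δ Δ'
                  → EigenRenaming ρ x Δ Δ' t₁ t₂
  eigenRenaming ρ {x} {Δ} {Δ'} t₁ t₂ x#Δ x#t₁ x#t₂ ρΔ = record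
    { y = y ; fresh-Δ' = All.tail (All.tail fresh) ; fresh₁ = All.head fresh
    ; fresh₂ = All.head (All.tail fresh) ; premise = premise
    ; subject₂ = ren-update-fresh t₂ ρ y x#t₂ ; eigen = update-same ρ x y }
    where
      y = boundAll (ren ρ t₁ ∷ ren ρ t₂ ∷ Δ')
      fresh = fresh-list (ren ρ t₁ ∷ ren ρ t₂ ∷ Δ') ≤-refl
      premise : RenamesInto (ρ [ x ↦ y ]) (app t₁ (var x) ∷ Δ) (app (ren ρ t₁) (var y) ∷ Δ')
      premise (here ≡.refl) = here (cong₂ app (ren-update-fresh t₁ ρ y x#t₁) (cong var (update-same ρ x y)))
      premise (there p)     = there (subst (_∈ Δ') (≡.sym (ren-update-fresh _ ρ y (All.lookup x#Δ p))) (ρΔ p))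

  rename : ∀ {Δ Δ' 𝓘 t} → Δ ⊢⟨ 𝓘 ⟩ t → (ρ : ℕ → ℕ) → RenamesInto ρ Δ Δ'
           → Δ' ⊢⟨ 𝓘 ⟩ ren ρ t
  rename (ax p)     ρ ρΔ = ax (ρΔ p)
  rename LH         ρ ρΔ = LH
  rename (LA τ)     ρ ρΔ = LA τ
  rename (Eq d e)   ρ ρΔ = Eq (rename d ρ ρΔ) (ren-βη ρ e)
  rename (Hi d)     ρ ρΔ = Hi (rename d ρ ρΔ)
  rename (Ξe d d₁)  ρ ρΔ = Ξe (rename d ρ ρΔ) (rename d₁ ρ ρΔ)
  rename (Ξi {t₁ = t₁} {t₂} x x#Δ x#t₁ x#t₂ d dL) ρ ρΔ =
    Ξi y fresh-Δ' fresh₁ fresh₂ (⊢-cast (cong₂ app subject₂ (cong var eigen)) (rename d _ premise))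
       (rename dL ρ ρΔ)
    where open EigenRenaming (eigenRenaming ρ t₁ t₂ x#Δ x#t₁ x#t₂ ρΔ)
  rename (ΞH {t₁ = t₁} {t₂} x x#Δ x#t₁ x#t₂ d dL) ρ ρΔ =
    ΞH y fresh-Δ' fresh₁ fresh₂
       (⊢-cast (cong (app (Ht sig)) (cong₂ app subject₂ (cong var eigen))) (rename d _ premise))
       (rename dL ρ ρΔ)
    where open EigenRenaming (eigenRenaming ρ t₁ t₂ x#Δ x#t₁ x#t₂ ρΔ)
  rename (FL {t₁ = t₁} {t₂} x x#Δ x#t₁ x#t₂ d dL) ρ ρΔ =
    FL y fresh-Δ' fresh₁ fresh₂ (⊢-cast (cong (app (Lt sig)) subject₂) (rename d _ premise))
       (rename dL ρ ρΔ)
    where open EigenRenaming (eigenRenaming ρ t₁ t₂ x#Δ x#t₁ x#t₂ ρΔ)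

  weaken : ∀ {Δ Δ' 𝓘 t} → Δ ⊢⟨ 𝓘 ⟩ t → Δ ⊆ Δ' → Δ' ⊢⟨ 𝓘 ⟩ t
  weaken {Δ' = Δ'} d Δ⊆Δ' = ⊢-cast (ren-id _ (λ _ → ≡.refl))
    (rename d (λ x → x) (λ {g} p → subst (_∈ Δ') (≡.sym (ren-id g (λ _ → ≡.refl))) (Δ⊆Δ' p)))

module Semantics {ℓ} {C : Set} (𝓒 : CombAlg ℓ) (I : C → CombAlg.Carrier 𝓒) where
  open CombAlg 𝓒
  open Interp 𝓒 I
  open IsEquivalence isEquiv renaming (refl to ≈-refl; sym to ≈-sym; trans to ≈-trans)

  abs-β : (u : ℕ → Carrier) (a : CL C) (d : Carrier) → evalCL u (abs a) · d ≈ evalCL (d ∷ᵥ u) a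
  abs-β u (cvar zero)    d = ≈-trans (S-law _ _ _) (K-law _ _)
  abs-β u (cvar (suc n)) d = K-law _ _
  abs-β u (ccon c)       d = K-law _ _
  abs-β u cS             d = K-law _ _
  abs-β u cK             d = K-law _ _
  abs-β u (cap a b)      d = ≈-trans (S-law _ _ _) (·-cong (abs-β u a d) (abs-β u b d))

  lam-β : (u : ℕ → Carrier) (t : Tm C) (d : Carrier) → ⟦ lam t ⟧ u · d ≈ ⟦ t ⟧ (d ∷ᵥ u)
  lam-β u t = abs-β u (toCL t)

  lam-ext : ∀ {u v} (t t' : Tm C) → (∀ d → ⟦ t ⟧ (d ∷ᵥ u) ≈ ⟦ t' ⟧ (d ∷ᵥ v))
            → ⟦ lam t ⟧ u ≈ ⟦ lam t' ⟧ v
  lam-ext t t' h = extensional _ _ λ d → ≈-trans (lam-β _ t d) (≈-trans (h d) (≈-sym (lam-β _ t' d)))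

  ⟦⟧-cong-free : (t : Tm C) {u v : ℕ → Carrier} → (∀ x → x freeIn t → u x ≈ v x)
                 → ⟦ t ⟧ u ≈ ⟦ t ⟧ v
  ⟦⟧-cong-free (var n)   h = h n here
  ⟦⟧-cong-free (con c)   h = ≈-refl
  ⟦⟧-cong-free (app t s) h =
    ·-cong (⟦⟧-cong-free t (λ x p → h x (appl p))) (⟦⟧-cong-free s (λ x p → h x (appr p)))
  ⟦⟧-cong-free (lam t) {u} {v} h = lam-ext t t λ d → ⟦⟧-cong-free t (h′ d)
    where h′ : ∀ d x → x freeIn t → (d ∷ᵥ u) x ≈ (d ∷ᵥ v) x
          h′ d zero    p = ≈-refl
          h′ d (suc x) p = h x (under p)

  ⟦⟧-cong : (t : Tm C) {u v : ℕ → Carrier} → (∀ x → u x ≈ v x) → ⟦ t ⟧ u ≈ ⟦ t ⟧ v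
  ⟦⟧-cong t h = ⟦⟧-cong-free t (λ x _ → h x)

  ⟦⟧-update-fresh : (t : Tm C) (u : ℕ → Carrier) {x : ℕ} (Z : Carrier) → x # t
                    → ⟦ t ⟧ (u [ x ↦ Z ]) ≈ ⟦ t ⟧ u
  ⟦⟧-update-fresh t u Z x#t =
    ⟦⟧-cong-free t (λ k p → reflexive (update-other u Z (λ k≡x → x#t (subst (_freeIn t) k≡x p))))

  ⟦⟧-ren : (t : Tm C) (ρ : ℕ → ℕ) (u : ℕ → Carrier) → ⟦ ren ρ t ⟧ u ≈ ⟦ t ⟧ (λ x → u (ρ x))
  ⟦⟧-ren (var n)   ρ u = ≈-refl
  ⟦⟧-ren (con c)   ρ u = ≈-refl
  ⟦⟧-ren (app t s) ρ u = ·-cong (⟦⟧-ren t ρ u) (⟦⟧-ren s ρ u)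
  ⟦⟧-ren (lam t)   ρ u =
    lam-ext (ren (ext {C} ρ) t) t λ d → ≈-trans (⟦⟧-ren t (ext {C} ρ) _) (⟦⟧-cong t h)
    where h : ∀ {d} x → (d ∷ᵥ u) (ext {C} ρ x) ≈ (d ∷ᵥ (λ x → u (ρ x))) x
          h zero    = ≈-refl
          h (suc x) = ≈-refl

  ⟦⟧-sub : (t : Tm C) (σ : ℕ → Tm C) (u : ℕ → Carrier) → ⟦ sub σ t ⟧ u ≈ ⟦ t ⟧ (λ x → ⟦ σ x ⟧ u)
  ⟦⟧-sub (var n)   σ u = ≈-refl
  ⟦⟧-sub (con c)   σ u = ≈-refl
  ⟦⟧-sub (app t s) σ u = ·-cong (⟦⟧-sub t σ u) (⟦⟧-sub s σ u)
  ⟦⟧-sub (lam t)   σ u = lam-ext (sub (exts σ) t) t λ d → ≈-trans (⟦⟧-sub t (exts σ) _) (⟦⟧-cong t h)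
    where h : ∀ {d} x → ⟦ exts σ x ⟧ (d ∷ᵥ u) ≈ (d ∷ᵥ (λ x → ⟦ σ x ⟧ u)) x
          h zero    = ≈-refl
          h (suc x) = ⟦⟧-ren (σ x) suc _

  ⟦⟧-βη : {t s : Tm C} → t =βη s → ∀ u → ⟦ t ⟧ u ≈ ⟦ s ⟧ u
  ⟦⟧-βη (β t s) u = ≈-trans (lam-β u t _) (≈-sym (≈-trans (⟦⟧-sub t (single s) u) (⟦⟧-cong t h)))
    where h : ∀ x → ⟦ single s x ⟧ u ≈ (⟦ s ⟧ u ∷ᵥ u) x
          h zero    = ≈-refl
          h (suc x) = ≈-refl
  ⟦⟧-βη (η t) u = extensional _ _ λ d →
    ≈-trans (lam-β u (app (ren suc t) (var zero)) d) (·-cong (⟦⟧-ren t suc (d ∷ᵥ u)) ≈-refl)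
  ⟦⟧-βη refl          u = ≈-refl
  ⟦⟧-βη (sym p)       u = ≈-sym (⟦⟧-βη p u)
  ⟦⟧-βη (trans p q)   u = ≈-trans (⟦⟧-βη p u) (⟦⟧-βη q u)
  ⟦⟧-βη (appcong p q) u = ·-cong (⟦⟧-βη p u) (⟦⟧-βη q u)
  ⟦⟧-βη (lamcong {t} {t'} p) u = lam-ext t t' λ d → ⟦⟧-βη p _

module Soundness {sig : Sig} {ℓ} (M : PreModel sig ℓ) where
  open PreModel M renaming (_≤_ to _⊑_)
  open Semantics alg I
  open Derivations sig
  open IsEquivalence isEquiv using (reflexive) renaming (refl to ≈-refl; sym to ≈-sym)

  Satisfies : State → (ℕ → Carrier) → List (Term sig) → Set ℓ
  Satisfies s u Δ = All (λ g → ς (⟦ g ⟧ u) s) Δ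

  ⟦⟧-eigen : (t : Term sig) (u : ℕ → Carrier) {x : ℕ} (Z : Carrier) → x # t
             → ⟦ app t (var x) ⟧ (u [ x ↦ Z ]) ≈ ⟦ t ⟧ u · Z
  ⟦⟧-eigen t u {x} Z x#t = ·-cong (⟦⟧-update-fresh t u Z x#t) (reflexive (update-same u x Z))

  eigen-premise : ∀ {Δ s s' x} t₁ u Z → s ⊑ s' → All (x #_) Δ → x # t₁ → Satisfies s u Δ
                  → ς (⟦ t₁ ⟧ u · Z) s' → Satisfies s' (u [ x ↦ Z ]) (app t₁ (var x) ∷ Δ)
  eigen-premise {s = s} {s'} {x} t₁ u Z s⊑s' x#Δ x#t₁ sat t₁Z =
    ς-resp (≈-sym (⟦⟧-eigen t₁ u Z x#t₁)) t₁Z ∷ persist x#Δ sat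
    where persist : ∀ {Δ} → All (x #_) Δ → Satisfies s u Δ → Satisfies s' (u [ x ↦ Z ]) Δ
          persist []          []        = []
          persist (x#g ∷ x#Δ) (g ∷ sat) =
            ς-resp (≈-sym (⟦⟧-update-fresh _ u Z x#g)) (ς-up s⊑s' g) ∷ persist x#Δ sat

  sound : ∀ {Δ 𝓘 t} → Δ ⊢⟨ 𝓘 ⟩ t → IsModel M 𝓘 → ∀ s u → Satisfies s u Δ → ς (⟦ t ⟧ u) s
  sound (ax p)    m s u sat = All.lookup sat p
  sound LH        m s u sat = IsModel.cond6 m s
  sound (LA τ)    m s u sat = IsModel.cond7 m τ s
  sound (Eq d e)  m s u sat = ς-resp (⟦⟧-βη e u) (sound d m s u sat)
  sound (Hi d)    m s u sat = IsModel.cond5 m _ s (sound d m s u sat)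
  sound (Ξe d d₁) m s u sat = IsModel.cond2 m _ _ s (sound d m s u sat) _ (sound d₁ m s u sat)
  sound (Ξi {t₁ = t₁} {t₂} x x#Δ x#t₁ x#t₂ d dL) m s u sat =
    IsModel.cond1 m _ _ s (sound dL m s u sat) λ s' s⊑s' Z t₁Z →
      ς-resp (⟦⟧-eigen t₂ u Z x#t₂)
        (sound d m s' (u [ x ↦ Z ]) (eigen-premise t₁ u Z s⊑s' x#Δ x#t₁ sat t₁Z))
  sound (ΞH {t₁ = t₁} {t₂} x x#Δ x#t₁ x#t₂ d dL) m s u sat =
    IsModel.cond3 m _ _ s (sound dL m s u sat) λ s' s⊑s' Z t₁Z →
      ς-resp (·-cong ≈-refl (⟦⟧-eigen t₂ u Z x#t₂))
        (sound d m s' (u [ x ↦ Z ]) (eigen-premise t₁ u Z s⊑s' x#Δ x#t₁ sat t₁Z))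
  sound (FL {t₁ = t₁} {t₂} x x#Δ x#t₁ x#t₂ d dL) m s u sat =
    IsModel.cond4 m _ _ s (sound dL m s u sat) λ s' s⊑s' Z t₁Z →
      ς-resp (·-cong ≈-refl (⟦⟧-update-fresh t₂ u Z x#t₂))
        (sound d m s' (u [ x ↦ Z ]) (eigen-premise t₁ u Z s⊑s' x#Δ x#t₁ sat t₁Z))

soundness : ∀ sig 𝓘 Γ t ℓ → Derivable sig 𝓘 Γ t → Valid sig 𝓘 ℓ Γ t
soundness sig 𝓘 Γ t ℓ (G , G⊆Γ , d) M isModel s u Γ-holds =
  Soundness.sound M d isModel s u (All.map (λ {g} → Γ-holds g) G⊆Γ)

module _ {C : Set} where

  Kᵗ Sᵗ : Tm C
  Kᵗ = lam (lam (var 1))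
  Sᵗ = lam (lam (lam (app (app (var 2) (var 0)) (app (var 1) (var 0)))))

  K-βη : (X Y : Tm C) → app (app Kᵗ X) Y =βη X
  K-βη X Y = trans (appcong (β _ X) refl) (trans (β _ Y) (≡⇒βη (sub-after-ren X _ suc (λ _ → ≡.refl))))

  S-βη : (X Y Z : Tm C) → app (app (app Sᵗ X) Y) Z =βη app (app X Z) (app Y Z)
  S-βη X Y Z =
    trans (appcong (appcong (β _ X) refl) refl) (trans (appcong (β _ Y) refl) (trans (β _ Z)
      (≡⇒βη (cong₂ app (cong₂ app X-restored ≡.refl)
                       (cong₂ app (sub-after-ren Y _ suc (λ _ → ≡.refl)) ≡.refl)))))
    where
      X-restored : sub (single Z) (sub (exts (single Y)) (ren suc (ren suc X))) ≡ X
      X-restored = ≡.trans (cong (λ w → sub (single Z) (sub (exts (single Y)) w)) (ren-ren X suc suc))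
        (≡.trans (cong (sub (single Z)) (≡.trans (sub-ren X _ _) (sub-var X suc)))
                 (sub-after-ren X _ suc (λ _ → ≡.refl)))

module TermModel (sig : Sig) (ℓ : Level) where
  open Sig sig

  termAlgebra : CombAlg ℓ
  termAlgebra = record
    { Carrier = Lift ℓ (Term sig)
    ; _≈_ = λ X Y → Lift ℓ (lower X =βη lower Y)
    ; isEquiv = record { refl = lift refl ; sym = λ p → lift (sym (lower p))
                       ; trans = λ p q → lift (trans (lower p) (lower q)) }
    ; _·_ = λ X Y → lift (app (lower X) (lower Y))
    ; ·-cong = λ p q → lift (appcong (lower p) (lower q))
    ; S = lift Sᵗ ; K = lift Kᵗ
    ; S-law = λ X Y Z → lift (S-βη _ _ _)
    ; K-law = λ X Y → lift (K-βη _ _)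
    ; extensional = λ M₁ M₂ h → lift (extensional-βη _ _ (λ X → lower (h (lift X))))
    }

  conᵗ : Const → Lift ℓ (Term sig)
  conᵗ c = lift (con c)

  open Interp termAlgebra conᵗ
  open Semantics termAlgebra conᵗ using (lam-β)

  ⟦⟧-is-sub : (t : Term sig) (σ : ℕ → Lift ℓ (Term sig))
              → lower (⟦ t ⟧ σ) =βη sub (λ n → lower (σ n)) t
  ⟦⟧-is-sub (var n)   σ = refl
  ⟦⟧-is-sub (con c)   σ = refl
  ⟦⟧-is-sub (app t s) σ = appcong (⟦⟧-is-sub t σ) (⟦⟧-is-sub s σ)
  ⟦⟧-is-sub (lam t)   σ = extensional-βη _ _ λ X → begin
      app (lower (⟦ lam t ⟧ σ)) X                  ≈⟨ lower (lam-β σ t (lift X)) ⟩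
      lower (⟦ t ⟧ (lift X ∷ᵥ σ))                  ≈⟨ ⟦⟧-is-sub t (lift X ∷ᵥ σ) ⟩
      sub (λ n → lower ((lift X ∷ᵥ σ) n)) t       ≡⟨ ≡.sym (single-after-exts X) ⟩
      sub (single X) (sub (exts σ′) t)             ≈⟨ β _ X ⟨
      app (sub σ′ (lam t)) X                       ∎
    where
      open import Relation.Binary.Reasoning.Setoid (βη-setoid {Const})
      σ′ = λ n → lower (σ n)
      single-after-exts : ∀ X → sub (single X) (sub (exts σ′) t) ≡ sub (λ n → lower ((lift X ∷ᵥ σ) n)) t
      single-after-exts X = ≡.trans (sub-sub t _ _) (sub-cong t h)
        where h : ∀ n → sub (single X) (exts σ′ n) ≡ lower ((lift X ∷ᵥ σ) n)
              h zero    = ≡.refl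
              h (suc n) = sub-after-ren (σ′ n) (single X) suc (λ _ → ≡.refl)

-- Renaming to even variables, so that odd variables stay fresh.
even : ℕ → ℕ
even n = 2 * n

half : ℕ → ℕ
half n = n / 2

half-even : ∀ n → half (even n) ≡ n
half-even n = ≡.trans (cong (_/ 2) (*-comm 2 n)) (m*n/n≡m n 2)

odd-fresh : ∀ {C : Set} (t : Tm C) b → suc (even b) # ren even t
odd-fresh t b fr with freeIn-ren t even fr
... | k , _ , 2b+1≡2k = even≢odd k b (≡.sym 2b+1≡2k)

module Canonical (sig : Sig) (Γ : Term sig → Set) (ℓ : Level) where
  open Derivations sig
  open TermModel sig ℓ
  open CombAlg termAlgebra using (Carrier; _·_)
  open Interp termAlgebra conᵗ

  State : Set ℓ
  State = Lift ℓ (List (Term sig))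

  _≼_ : State → State → Set ℓ
  Δ ≼ Δ' = Lift ℓ (∃[ E ] lower Δ' ≡ E ++ lower Δ)

  ≼-isPartialOrder : IsPartialOrder _≡_ _≼_
  ≼-isPartialOrder = record
    { isPreorder = record
      { isEquivalence = ≡.isEquivalence
      ; reflexive = λ { ≡.refl → lift ([] , ≡.refl) }
      ; trans = λ { {lift a} (lift (E , b≡Ea)) (lift (F , c≡Fb)) →
          lift (F ++ E , ≡.trans c≡Fb (≡.trans (cong (F ++_) b≡Ea) (≡.sym (++-assoc F E a)))) } }
    ; antisym = antisym }
    where
      antisym : ∀ {a b} → a ≼ b → b ≼ a → a ≡ b
      -- a ≡ (F ++ E) ++ a forces E to be empty
      antisym {lift a} (lift (E , b≡Ea)) (lift (F , a≡Fb)) =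
        cong lift (≡.sym (≡.trans b≡Ea (cong (_++ a) E≡[])))
        where E≡[] = ++-conicalʳ F E (++-identityˡ-unique (F ++ E)
                       (≡.trans a≡Fb (≡.trans (cong (F ++_) b≡Ea) (≡.sym (++-assoc F E a)))))

  context : List (Term sig) → List (Term sig) → List (Term sig)
  context G Δ = Δ ++ map (ren even) G

  context-monoˡ : ∀ {G G'} Δ → G ⊆ G' → context G Δ ⊆ context G' Δ
  context-monoˡ Δ G⊆G' = ⊆.++⁺ʳ Δ (⊆.map⁺ (ren even) G⊆G')

  Supports : System → Carrier → State → Set ℓ
  Supports 𝓘 X Δ = Lift ℓ (∃[ G ] (All Γ G × context G (lower Δ) ⊢⟨ 𝓘 ⟩ lower X))

  canonical : System → PreModel sig ℓ
  canonical 𝓘 = record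
    { State = State ; _≤_ = _≼_ ; isPO = ≼-isPartialOrder ; alg = termAlgebra ; I = conᵗ
    ; ς = Supports 𝓘
    ; ς-up = λ { {s = lift Δ} (lift (E , ≡.refl)) (lift (G , G⊆Γ , d)) →
                 lift (G , G⊆Γ , weaken d (⊆.++⁺ˡ _ (⊆.xs⊆ys++xs Δ E))) }
    ; ς-resp = λ { (lift X=Y) (lift (G , G⊆Γ , d)) → lift (G , G⊆Γ , Eq d X=Y) } }

  eigenvar : List (Term sig) → Term sig → Term sig → ℕ
  eigenvar Δ X Y = suc (even (boundAll (X ∷ Y ∷ Δ)))

  eigenvar-fresh : ∀ G Δ X Y → let y = eigenvar Δ X Y in All (y #_) (context G Δ) × y # X × y # Y
  eigenvar-fresh G Δ X Y =
    AllP.++⁺ (All.tail (All.tail fresh)) (AllP.map⁺ (All.universal (λ g → odd-fresh g b) G))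
    , All.head fresh , All.head (All.tail fresh)
    where
      b = boundAll (X ∷ Y ∷ Δ)
      fresh = fresh-list (X ∷ Y ∷ Δ) (≤-trans (m≤n*m b 2) (n≤1+n _))

  EigenRule : System → (Term sig → Term sig → Term sig) → (Term sig → Term sig → Term sig) → Set
  EigenRule 𝓘 premise conclusion = ∀ {Δ X Y} y → All (y #_) Δ → y # X → y # Y
    → app X (var y) ∷ Δ ⊢⟨ 𝓘 ⟩ premise Y (var y) → Δ ⊢⟨ 𝓘 ⟩ app (Lt sig) X
    → Δ ⊢⟨ 𝓘 ⟩ conclusion X Y

  premise-at-eigenvar : ∀ {𝓘} (B : Carrier → Carrier) {X Y Δ}
    → (∀ s' → lift Δ ≼ s' → ∀ Z → Supports 𝓘 (lift X · Z) s' → Supports 𝓘 (B Z) s')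
    → let y = eigenvar Δ X Y in Supports 𝓘 (B (lift (var y))) (lift (app X (var y) ∷ Δ))
  premise-at-eigenvar B h = h _ (lift (_ ∷ [] , ≡.refl)) _ (lift ([] , [] , ax (here ≡.refl)))

  pool-left : ∀ G₁ G₀ Δ → context G₁ Δ ⊆ context (G₁ ++ G₀) Δ
  pool-left G₁ G₀ Δ = context-monoˡ Δ (⊆.xs⊆xs++ys G₁ G₀)

  pool-right : ∀ G₁ G₀ Δ → context G₀ Δ ⊆ context (G₁ ++ G₀) Δ
  pool-right G₁ G₀ Δ = context-monoˡ Δ (⊆.xs⊆ys++xs G₀ G₁)

  eigen-condition : ∀ {𝓘} premise conclusion → EigenRule 𝓘 premise conclusion
    → (B : Carrier → Carrier) {X Y : Term sig} {target : Carrier} {s : State}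
    → (∀ Z → lower (B Z) =βη premise Y (lower Z)) → conclusion X Y =βη lower target
    → Supports 𝓘 (lift (app (Lt sig) X)) s
    → (∀ s' → s ≼ s' → ∀ Z → Supports 𝓘 (lift X · Z) s' → Supports 𝓘 (B Z) s')
    → Supports 𝓘 target s
  eigen-condition {𝓘} premise conclusion rule B {X} {Y} {target} {lift Δ} B=premise conclusion=target
                  (lift (G₀ , G₀⊆Γ , dL)) h = conclude (lower (premise-at-eigenvar B {X} {Y} {Δ} h))
    where
      y = eigenvar Δ X Y
      conclude : ∃[ G₁ ] (All Γ G₁ × app X (var y) ∷ context G₁ Δ ⊢⟨ 𝓘 ⟩ lower (B (lift (var y))))
                 → Supports 𝓘 target (lift Δ)
      conclude (G₁ , G₁⊆Γ , d) =
        lift (G₁ ++ G₀ , AllP.++⁺ G₁⊆Γ G₀⊆Γ ,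
          Eq (rule y y#context y#X y#Y
                (Eq (weaken d (⊆.∷⁺ʳ _ (pool-left G₁ G₀ Δ))) (B=premise (lift (var y))))
                (weaken dL (pool-right G₁ G₀ Δ)))
             conclusion=target)
        where
          fresh = eigenvar-fresh (G₁ ++ G₀) Δ X Y
          y#context = proj₁ fresh
          y#X = proj₁ (proj₂ fresh)
          y#Y = proj₂ (proj₂ fresh)

  Hᵐ-βη : lower (⟦ Ht sig ⟧₀) =βη Ht sig
  Hᵐ-βη = ⟦⟧-is-sub (Ht sig) (λ _ → lift Kᵗ)

  Fᵐ-βη : lower (⟦ Ft sig ⟧₀) =βη Ft sig
  Fᵐ-βη = ⟦⟧-is-sub (Ft sig) (λ _ → lift Kᵗ)

  canonical-cond4 : ∀ 𝓘 → Cond4 (canonical 𝓘) 𝓘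
  canonical-cond4 𝓘₀ = lift tt
  canonical-cond4 𝓘ω (lift X) (lift Y) s =
    eigen-condition (λ Y _ → app (Lt sig) Y) (λ X Y → app (Lt sig) (app (app (Ft sig) X) Y)) (λ y → FL y)
      (λ _ → lift (app (Lt sig) Y)) (λ _ → refl) (appcong refl (appcong (appcong (sym Fᵐ-βη) refl) refl))

  canonical-isModel : ∀ 𝓘 → IsModel (canonical 𝓘) 𝓘
  canonical-isModel 𝓘 = record
    { cond1 = λ X Y s →
        eigen-condition (λ Y z → app Y z) (λ X Y → app (app (Ξt sig) X) Y) (λ y → Ξi y)
          (λ Z → Y · Z) (λ _ → refl) refl
    ; cond2 = λ { X Y (lift Δ) (lift (G₀ , G₀⊆Γ , dΞ)) Z (lift (G₁ , G₁⊆Γ , dX)) →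
        lift (G₁ ++ G₀ , AllP.++⁺ G₁⊆Γ G₀⊆Γ ,
          Ξe (weaken dΞ (pool-right G₁ G₀ Δ)) (weaken dX (pool-left G₁ G₀ Δ))) }
    ; cond3 = λ X Y s →
        eigen-condition (λ Y z → app (Ht sig) (app Y z)) (λ X Y → app (Ht sig) (app (app (Ξt sig) X) Y))
          (λ y → ΞH y) (λ Z → ⟦ Ht sig ⟧₀ · (Y · Z))
          (λ _ → appcong Hᵐ-βη refl) (appcong (sym Hᵐ-βη) refl)
    ; cond4 = canonical-cond4 𝓘
    ; cond5 = λ { X s (lift (G , G⊆Γ , d)) → lift (G , G⊆Γ , Eq (Hi d) (appcong (sym Hᵐ-βη) refl)) }
    ; cond6 = λ s → lift ([] , [] , Eq LH (appcong refl (sym Hᵐ-βη)))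
    ; cond7 = λ τ s → lift ([] , [] , LA τ) }

  evenVal : ℕ → Carrier
  evenVal n = lift (var (even n))

  ⟦⟧-evenVal : ∀ t → lower (⟦ t ⟧ evenVal) =βη ren even t
  ⟦⟧-evenVal t = trans (⟦⟧-is-sub t evenVal) (≡⇒βη (sub-var t even))

  completeness : ∀ 𝓘 t → Valid sig 𝓘 ℓ Γ t → Derivable sig 𝓘 Γ t
  completeness 𝓘 t valid = read-off (valid (canonical 𝓘) (canonical-isModel 𝓘) (lift []) evenVal Γ-holds)
    where
      Γ-holds : ∀ t' → Γ t' → Supports 𝓘 (⟦ t' ⟧ evenVal) (lift [])
      Γ-holds t' γ = lift (t' ∷ [] , γ ∷ [] , Eq (ax (here ≡.refl)) (sym (⟦⟧-evenVal t')))
      read-off : Supports 𝓘 (⟦ t ⟧ evenVal) (lift []) → Derivable sig 𝓘 Γ t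
      read-off (lift (G , G⊆Γ , d)) =
        G , G⊆Γ , ⊢-cast (ren-inverse t half-even) (rename (Eq d (⟦⟧-evenVal t)) half undo)
        where undo : RenamesInto half (map (ren even) G) G
              undo p with ∈-map⁻ (ren even) p
              ... | g , g∈G , ≡.refl = subst (_∈ G) (≡.sym (ren-inverse g half-even)) g∈G

mainTheorem4 : (sig : Sig) (𝓘 : System) (Γ : Term sig → Set) (t : Term sig) (ℓ : Level)
               → Valid sig 𝓘 ℓ Γ t ⇔ Derivable sig 𝓘 Γ t
mainTheorem4 sig 𝓘 Γ t ℓ = mk⇔ (Canonical.completeness sig Γ ℓ 𝓘 t) (soundness sig 𝓘 Γ t ℓ)
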